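{- If $a$ and $b$ are integers satisfying $a\ge b>1$, then \[ (a+1)^{a+1}(b-1)^{b-1} > a^a b^b. \] -}

module Defs where

{-# OPTIONS --safe #-}
-- The function k ↦ k^k is strictly log-convex on ℕ: (t+1)^(2t+2) < (t+2)^(t+2) t^t.
-- Writing y = t(t+2), so that (t+1)² = y+1, this is (y+1)^(t+1) < (t+2)² y^t, which
-- follows from Bernoulli's inequality for (1 - 1/(y+1))^t. Log-convexity makes the ratio
-- (k+1)^(k+1) / k^k strictly increasing, and comparing it at k = b-1 < a gives the theorem.
module Submission where

open import Defs
open import Data.Integer using (ℤ; _+_; _-_; _*_; _≤_; _<_; _>_; _≥_; +_)
open import Data.Integer using (_^_)
open import Data.Integer.Base using (∣_∣)
import Data.Integer as ℤ
import Data.Integer.Properties as ℤ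
open import Data.Nat as ℕ using (ℕ; zero; suc; s≤s)
open import Function using (_∘_)
open import Data.Nat.Properties
open import Data.Nat.Tactic.RingSolver using (solve-∀)
open import Data.Sum using (inj₁; inj₂)
open import Relation.Binary.PropositionalEquality

^-distribʳ-* : ∀ m n o → (m ℕ.* n) ℕ.^ o ≡ m ℕ.^ o ℕ.* n ℕ.^ o
^-distribʳ-* m n zero    = refl
^-distribʳ-* m n (suc o) = begin
  m ℕ.* n ℕ.* (m ℕ.* n) ℕ.^ o             ≡⟨ cong (m ℕ.* n ℕ.*_) (^-distribʳ-* m n o) ⟩
  m ℕ.* n ℕ.* (m ℕ.^ o ℕ.* n ℕ.^ o)       ≡⟨ regroup m n (m ℕ.^ o) (n ℕ.^ o) ⟩
  m ℕ.* m ℕ.^ o ℕ.* (n ℕ.* n ℕ.^ o)       ∎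
  where
  open ≡-Reasoning
  regroup : ∀ a b c d → a ℕ.* b ℕ.* (c ℕ.* d) ≡ a ℕ.* c ℕ.* (b ℕ.* d)
  regroup = solve-∀

pos-^ : ∀ m n → + (m ℕ.^ n) ≡ (+ m) ^ n
pos-^ m zero    = refl
pos-^ m (suc n) = trans (ℤ.pos-* m (m ℕ.^ n)) (cong (+ m *_) (pos-^ m n))

-- Bernoulli's inequality (1 - 1/x)^t ≥ 1 - t/x for x = 1+y, multiplied by x^(t+1).
bernoulli : ∀ y t → suc y ℕ.^ suc t ℕ.≤ suc y ℕ.* y ℕ.^ t ℕ.+ t ℕ.* suc y ℕ.^ t
bernoulli y zero    = ≤-reflexive (sym (+-identityʳ _))
bernoulli y (suc t) = begin
  x ℕ.* x ℕ.^ suc t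
    ≤⟨ *-monoʳ-≤ x (bernoulli y t) ⟩
  x ℕ.* (x ℕ.* y ℕ.^ t ℕ.+ t ℕ.* x ℕ.^ t)
    ≡⟨ expand y (y ℕ.^ t) t (x ℕ.^ t) ⟩
  x ℕ.* (y ℕ.* y ℕ.^ t) ℕ.+ x ℕ.* y ℕ.^ t ℕ.+ t ℕ.* (x ℕ.* x ℕ.^ t)
    ≤⟨ +-monoˡ-≤ (t ℕ.* (x ℕ.* x ℕ.^ t)) (+-monoʳ-≤ (x ℕ.* (y ℕ.* y ℕ.^ t)) (*-monoʳ-≤ x (^-monoˡ-≤ t (n≤1+n y)))) ⟩
  x ℕ.* (y ℕ.* y ℕ.^ t) ℕ.+ x ℕ.* x ℕ.^ t ℕ.+ t ℕ.* (x ℕ.* x ℕ.^ t)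
    ≡⟨ +-assoc (x ℕ.* (y ℕ.* y ℕ.^ t)) _ _ ⟩
  x ℕ.* (y ℕ.* y ℕ.^ t) ℕ.+ suc t ℕ.* (x ℕ.* x ℕ.^ t)
    ∎
  where
  open ≤-Reasoning
  x = suc y
  expand : ∀ y p t q → suc y ℕ.* (suc y ℕ.* p ℕ.+ t ℕ.* q)
                     ≡ suc y ℕ.* (y ℕ.* p) ℕ.+ suc y ℕ.* p ℕ.+ t ℕ.* (suc y ℕ.* q)
  expand = solve-∀

-- With y = t(t+2), i.e. 1+y = (t+1)², Bernoulli leaves the polynomial gap
-- (t+2)²(1+y) - (1+y)² - (t+2)² t = t³ + 3t² + 4t + 3 > 0.
[1+y]^[1+t]<[2+t]²y^t : ∀ t → let y = t ℕ.* suc (suc t) in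
  suc y ℕ.^ suc t ℕ.< suc (suc t) ℕ.* suc (suc t) ℕ.* y ℕ.^ t
[1+y]^[1+t]<[2+t]²y^t t = *-cancelˡ-< x _ _ (+-cancelʳ-< (c ℕ.* (t ℕ.* x ℕ.^ t)) _ _ (begin-strict
  x ℕ.* (x ℕ.* x ℕ.^ t) ℕ.+ c ℕ.* (t ℕ.* x ℕ.^ t)  ≡⟨ factor x c t (x ℕ.^ t) ⟩
  (x ℕ.* x ℕ.+ c ℕ.* t) ℕ.* x ℕ.^ t               <⟨ *-monoˡ-< (x ℕ.^ t) {{m^n≢0 x t}} gap ⟩
  c ℕ.* x ℕ.* x ℕ.^ t                             ≡⟨ *-assoc c x (x ℕ.^ t) ⟩
  c ℕ.* (x ℕ.* x ℕ.^ t)                           ≤⟨ *-monoʳ-≤ c (bernoulli y t) ⟩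
  c ℕ.* (x ℕ.* y ℕ.^ t ℕ.+ t ℕ.* x ℕ.^ t)         ≡⟨ distribute x c (y ℕ.^ t) t (x ℕ.^ t) ⟩
  x ℕ.* (c ℕ.* y ℕ.^ t) ℕ.+ c ℕ.* (t ℕ.* x ℕ.^ t) ∎))
  where
  open ≤-Reasoning
  y = t ℕ.* suc (suc t)
  x = suc y
  c = suc (suc t) ℕ.* suc (suc t)
  gap : x ℕ.* x ℕ.+ c ℕ.* t ℕ.< c ℕ.* x
  gap = begin-strict
    x ℕ.* x ℕ.+ c ℕ.* t                                                 <⟨ m<m+n _ 0<1+n ⟩
    x ℕ.* x ℕ.+ c ℕ.* t ℕ.+ suc (t ℕ.* t ℕ.* t ℕ.+ 3 ℕ.* t ℕ.* t ℕ.+ 4 ℕ.* t ℕ.+ 2) ≡⟨ gap-identity t ⟩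
    c ℕ.* x                                                             ∎
    where
    gap-identity : ∀ t → let x = suc (t ℕ.* suc (suc t)) ; c = suc (suc t) ℕ.* suc (suc t) in
      x ℕ.* x ℕ.+ c ℕ.* t ℕ.+ suc (t ℕ.* t ℕ.* t ℕ.+ 3 ℕ.* t ℕ.* t ℕ.+ 4 ℕ.* t ℕ.+ 2) ≡ c ℕ.* x
    gap-identity = solve-∀
  factor : ∀ x c t q → x ℕ.* (x ℕ.* q) ℕ.+ c ℕ.* (t ℕ.* q) ≡ (x ℕ.* x ℕ.+ c ℕ.* t) ℕ.* q
  factor = solve-∀
  distribute : ∀ x c p t q → c ℕ.* (x ℕ.* p ℕ.+ t ℕ.* q) ≡ x ℕ.* (c ℕ.* p) ℕ.+ c ℕ.* (t ℕ.* q)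
  distribute = solve-∀

selfPow : ℕ → ℕ
selfPow n = n ℕ.^ n

selfPow-strictlyLogConvex : ∀ t → selfPow (suc t) ℕ.* selfPow (suc t) ℕ.< selfPow (suc (suc t)) ℕ.* selfPow t
selfPow-strictlyLogConvex t = begin-strict
  selfPow (suc t) ℕ.* selfPow (suc t)   ≡⟨ ^-distribʳ-* (suc t) (suc t) (suc t) ⟨
  (suc t ℕ.* suc t) ℕ.^ suc t           ≡⟨ cong (ℕ._^ suc t) (square t) ⟩
  suc (t ℕ.* s) ℕ.^ suc t               <⟨ [1+y]^[1+t]<[2+t]²y^t t ⟩
  s ℕ.* s ℕ.* (t ℕ.* s) ℕ.^ t           ≡⟨ cong (s ℕ.* s ℕ.*_) (^-distribʳ-* t s t) ⟩
  s ℕ.* s ℕ.* (t ℕ.^ t ℕ.* s ℕ.^ t)     ≡⟨ regroup s (t ℕ.^ t) (s ℕ.^ t) ⟩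
  selfPow s ℕ.* selfPow t               ∎
  where
  open ≤-Reasoning
  s = suc (suc t)
  square : ∀ t → suc t ℕ.* suc t ≡ suc (t ℕ.* suc (suc t))
  square = solve-∀
  regroup : ∀ s p q → s ℕ.* s ℕ.* (p ℕ.* q) ≡ s ℕ.* (s ℕ.* q) ℕ.* p
  regroup = solve-∀

-- a/b < c/d < e/f ⇒ a/b < e/f, cross-multiplied; strictness makes zero denominators harmless.
cross-<-trans : ∀ {a b c d e f} → a ℕ.* d ℕ.< c ℕ.* b → c ℕ.* f ℕ.< e ℕ.* d → a ℕ.* f ℕ.< e ℕ.* b
cross-<-trans {a} {b} {c} {d} {e} {f} ad<cb cf<ed = *-cancelʳ-< (c ℕ.* d) _ _ (begin-strict
  a ℕ.* f ℕ.* (c ℕ.* d)     ≡⟨ swap a f c d ⟩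
  a ℕ.* d ℕ.* (c ℕ.* f)     <⟨ *-mono-< ad<cb cf<ed ⟩
  c ℕ.* b ℕ.* (e ℕ.* d)     ≡⟨ swap c b e d ⟩
  c ℕ.* d ℕ.* (e ℕ.* b)     ≡⟨ *-comm (c ℕ.* d) (e ℕ.* b) ⟩
  e ℕ.* b ℕ.* (c ℕ.* d)     ∎)
  where
  open ≤-Reasoning
  swap : ∀ p q r s → p ℕ.* q ℕ.* (r ℕ.* s) ≡ p ℕ.* s ℕ.* (r ℕ.* q)
  swap = solve-∀

ratio-strictlyIncreasing : ∀ (f g : ℕ → ℕ) → (∀ t → f t ℕ.* g (suc t) ℕ.< f (suc t) ℕ.* g t) →
                           ∀ {m n} → m ℕ.< n → f m ℕ.* g n ℕ.< f n ℕ.* g m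
ratio-strictlyIncreasing f g step {m} {suc n} m<1+n with m<1+n⇒m<n∨m≡n m<1+n
... | inj₂ refl = step m
... | inj₁ m<n  = cross-<-trans {f m} {g m} {f n} {g n} {f (suc n)} {g (suc n)}
                    (ratio-strictlyIncreasing f g step m<n) (step n)

pos-selfPow-* : ∀ j k → + (selfPow j ℕ.* selfPow k) ≡ (+ j) ^ j * (+ k) ^ k
pos-selfPow-* j k = trans (ℤ.pos-* (selfPow j) (selfPow k)) (cong₂ _*_ (pos-^ j j) (pos-^ k k))

lemma3p1 : ∀ (a b : ℤ) → a ≥ b → b > + 1 →
    (a + + 1) ^ ∣ a + + 1 ∣ * (b - + 1) ^ ∣ b - + 1 ∣ > a ^ ∣ a ∣ * b ^ ∣ b ∣
lemma3p1 _     (+ 0)             _              (ℤ.+<+ ())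
lemma3p1 _     (+ 1)             _              (ℤ.+<+ (s≤s ()))
lemma3p1 (+ n) (+ suc (suc m))   (ℤ.+≤+ 2+m≤n) _ = begin-strict
  (+ n) ^ n * (+ b) ^ b                         ≡⟨ pos-selfPow-* n b ⟨
  + (selfPow n ℕ.* selfPow b)                   ≡⟨ cong +_ (*-comm (selfPow n) (selfPow b)) ⟩
  + (selfPow b ℕ.* selfPow n)                   <⟨ ℤ.+<+ (ratio-strictlyIncreasing (selfPow ∘ suc) selfPow selfPow-strictlyLogConvex 2+m≤n) ⟩
  + (selfPow (suc n) ℕ.* selfPow (suc m))       ≡⟨ cong (λ k → + (selfPow k ℕ.* selfPow (suc m))) (+-comm 1 n) ⟩
  + (selfPow (n ℕ.+ 1) ℕ.* selfPow (suc m))     ≡⟨ pos-selfPow-* (n ℕ.+ 1) (suc m) ⟩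
  (+ n + + 1) ^ (n ℕ.+ 1) * (+ suc m) ^ suc m   ∎
  where
  open ℤ.≤-Reasoning
  b = suc (suc m)
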